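{- Let $\sigma,\tau\in\mathrm{PAut}(T_k)$. Then $\sigma\,\mathcal D\,\tau$ if and only if $\mathrm{dom}(\sigma)\cong\mathrm{dom}(\tau)$, i.e. the subgraphs of $T_k$ induced on $\mathrm{dom}(\sigma)$ and on $\mathrm{dom}(\tau)$ are isomorphic.
   Context: $T_k$ is the rooted $k$-level $d$-regular tree (root at level 0, every vertex at level $<k$ has exactly $d$ children). $\mathrm{PAut}(T_k)$ is the semigroup of partial automorphisms of $T_k$: injective partial maps $\varphi$ of the vertex set that are graph isomorphisms from the subgraph induced on the domain onto the subgraph induced on the range, with composition $(\varphi\psi)(x)=\psi(\varphi(x))$. $\mathcal D$ is Green's $\mathcal D$-relation on this semigroup. -}

module Defs where

open import Data.Nat using (ℕ; _≤_)
open import Data.Fin using (Fin)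
open import Data.List using (List; length; _∷_)
open import Data.Maybe using (Maybe; just; nothing; _>>=_)
open import Data.Product using (Σ; ∃; _×_; _,_; proj₁; proj₂)
open import Data.Sum using (_⊎_)
open import Function.Bundles using (_⇔_)
open import Relation.Binary.PropositionalEquality using (_≡_)

-- Vertices of the rooted k-level d-regular tree T_k (for fixed d):
-- words over Fin d of length ≤ k; the empty word is the root (level 0),
-- and the children of a word w are the words c ∷ w, c : Fin d.
Vertex : (d k : ℕ) → Set
Vertex d k = Σ (List (Fin d)) (λ w → length w ≤ k)

Child : ∀ {d k} → Vertex d k → Vertex d k → Set
Child {d} u v = ∃ λ (c : Fin d) → proj₁ v ≡ c ∷ proj₁ u

Adj : ∀ {d k} → Vertex d k → Vertex d k → Set
Adj u v = Child u v ⊎ Child v u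

PMap : (d k : ℕ) → Set
PMap d k = Vertex d k → Maybe (Vertex d k)

_≈_ : ∀ {d k} → PMap d k → PMap d k → Set
f ≈ g = ∀ x → f x ≡ g x

-- composition with (φψ)(x) = ψ(φ(x))
_⨾_ : ∀ {d k} → PMap d k → PMap d k → PMap d k
(f ⨾ g) x = f x >>= g

record IsPAut {d k} (f : PMap d k) : Set where
  field
    injective : ∀ x y z → f x ≡ just z → f y ≡ just z → x ≡ y
    adj-iso   : ∀ x y x′ y′ → f x ≡ just x′ → f y ≡ just y′ →
                Adj x y ⇔ Adj x′ y′

PAut : (d k : ℕ) → Set
PAut d k = Σ (PMap d k) IsPAut

_·_ : ∀ {d k} → PAut d k → PAut d k → PMap d k
σ · τ = proj₁ σ ⨾ proj₁ τ

-- Green's preorders via S¹σ ⊆ S¹τ  and  σS¹ ⊆ τS¹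
_≤L_ : ∀ {d k} → PAut d k → PAut d k → Set
_≤L_ {d} {k} σ τ = (proj₁ σ ≈ proj₁ τ) ⊎ (∃ λ (a : PAut d k) → proj₁ σ ≈ (a · τ))

_≤R_ : ∀ {d k} → PAut d k → PAut d k → Set
_≤R_ {d} {k} σ τ = (proj₁ σ ≈ proj₁ τ) ⊎ (∃ λ (a : PAut d k) → proj₁ σ ≈ (τ · a))

_𝓛_ : ∀ {d k} → PAut d k → PAut d k → Set
σ 𝓛 τ = (σ ≤L τ) × (τ ≤L σ)

_𝓡_ : ∀ {d k} → PAut d k → PAut d k → Set
σ 𝓡 τ = (σ ≤R τ) × (τ ≤R σ)

_𝓓_ : ∀ {d k} → PAut d k → PAut d k → Set
_𝓓_ {d} {k} σ τ = ∃ λ (ρ : PAut d k) → (σ 𝓛 ρ) × (ρ 𝓡 τ)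

Dom : ∀ {d k} → PMap d k → Set
Dom {d} {k} f = Σ (Vertex d k) (λ x → ∃ λ y → f x ≡ just y)

record DomIso {d k} (f g : PMap d k) : Set where
  field
    to      : Dom f → Dom g
    from    : Dom g → Dom f
    from∘to : ∀ x → proj₁ (from (to x)) ≡ proj₁ x
    to∘from : ∀ y → proj₁ (to (from y)) ≡ proj₁ y
    adj     : ∀ x y → Adj (proj₁ x) (proj₁ y) ⇔ Adj (proj₁ (to x)) (proj₁ (to y))

_≅dom_ : ∀ {d k} → PAut d k → PAut d k → Set
σ ≅dom τ = DomIso (proj₁ σ) (proj₁ τ)

-- In an inverse semigroup of partial bijections, σ 𝓛 ρ says that σ and ρ have the same range,
-- so that x ↦ ρ⁻¹(σ x) is an isomorphism dom σ ≅ dom ρ, and ρ 𝓡 τ says that ρ and τ have the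
-- same domain. Conversely, an isomorphism φ : dom σ ≅ dom τ of induced subgraphs is itself a
-- partial automorphism, and ρ = φ⁻¹ ⨾ σ has the range of σ and the domain of τ, whence
-- σ 𝓛 ρ 𝓡 τ. Inverses of partial maps are available because T_k is finite: preimages are
-- found by exhaustive search over the words of length at most k.
module Submission where

open import Defs
open import Data.Nat using (ℕ; zero; suc; _≤_; z≤n; s≤s; _≤?_)
open import Data.Nat.Properties using (≤-irrelevant)
open import Data.Fin using (Fin)
import Data.Fin.Properties as Fin
open import Data.List using (List; []; _∷_; length)
import Data.List.Properties as List
open import Data.Maybe using (Maybe; just; nothing; _>>=_)
import Data.Maybe.Properties as Maybe
open import Data.Product using (Σ; ∃; _×_; _,_; proj₁; proj₂)
open import Data.Sum using (_⊎_; inj₁; inj₂)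
open import Data.Empty using (⊥-elim)
open import Function using (_∘_)
open import Function.Bundles using (_⇔_; mk⇔)
import Function.Properties.Equivalence as ⇔
open import Relation.Binary.Definitions using (DecidableEquality)
open import Relation.Binary.PropositionalEquality
  using (_≡_; refl; sym; trans; cong; subst)
open import Relation.Nullary using (Dec; yes; no; map′; _⊎-dec_)
open import Relation.Unary using (Decidable)
import Axiom.UniquenessOfIdentityProofs as UIP

module _ {d : ℕ} where

  ∃-bounded-word? : {P : List (Fin d) → Set} → Decidable P →
                    ∀ n → Dec (∃ λ w → length w ≤ n × P w)
  ∃-bounded-word? P? zero = map′ (λ p → [] , z≤n , p) (λ { ([] , _ , p) → p }) (P? [])
  ∃-bounded-word? {P} P? (suc n) =
    map′ into outof (P? [] ⊎-dec Fin.any? (λ c → ∃-bounded-word? (P? ∘ (c ∷_)) n))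
    where
    into : P [] ⊎ (∃ λ c → ∃ λ w → length w ≤ n × P (c ∷ w)) →
           ∃ λ w → length w ≤ suc n × P w
    into (inj₁ p)               = [] , z≤n , p
    into (inj₂ (c , w , l , p)) = c ∷ w , s≤s l , p
    outof : (∃ λ w → length w ≤ suc n × P w) →
            P [] ⊎ (∃ λ c → ∃ λ w → length w ≤ n × P (c ∷ w))
    outof ([] , _ , p)        = inj₁ p
    outof (c ∷ w , s≤s l , p) = inj₂ (c , w , l , p)

module _ {d k : ℕ} where

  private
    V : Set
    V = Vertex d k

  ∃-vertex? : {Q : V → Set} → Decidable Q → Dec (∃ Q)
  ∃-vertex? {Q} Q? =
    map′ (λ { (w , _ , l , q) → (w , l) , q })
         (λ { ((w , l) , q) → w , l , l , q })
         (∃-bounded-word? P? k)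
    where
    P : List (Fin d) → Set
    P w = Σ (length w ≤ k) λ l → Q (w , l)
    P? : Decidable P
    P? w with length w ≤? k
    ... | no  l̸ = no (l̸ ∘ proj₁)
    ... | yes l = map′ (l ,_) (λ { (l′ , q) → subst (λ l″ → Q (w , l″)) (≤-irrelevant l′ l) q }) (Q? (w , l))

  _≟ᵛ_ : DecidableEquality V
  (w , l) ≟ᵛ (w′ , l′) with List.≡-dec Fin._≟_ w w′
  ... | yes refl = yes (cong (w ,_) (≤-irrelevant l l′))
  ... | no  w≢w′ = no (w≢w′ ∘ cong proj₁)

  Dom-≡ : (f : PMap d k) {a b : Dom f} → proj₁ a ≡ proj₁ b → a ≡ b
  Dom-≡ f {x , y , e} {.x , y′ , e′} refl with Maybe.just-injective (trans (sym e) e′)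
  ... | refl = cong (λ e″ → x , y , e″) (UIP.Decidable⇒UIP.≡-irrelevant (Maybe.≡-dec _≟ᵛ_) e e′)

  >>=-≡-just : (m : Maybe V) (g : PMap d k) {z : V} →
               (m >>= g) ≡ just z → ∃ λ u → m ≡ just u × g u ≡ just z
  >>=-≡-just (just u) g e = u , refl , e

  inverse : PMap d k → PMap d k
  inverse f z with ∃-vertex? (λ x → Maybe.≡-dec _≟ᵛ_ (f x) (just z))
  ... | yes (x , _) = just x
  ... | no  _       = nothing

  inverse-sound : (f : PMap d k) {z x : V} → inverse f z ≡ just x → f x ≡ just z
  inverse-sound f {z} e with ∃-vertex? (λ x → Maybe.≡-dec _≟ᵛ_ (f x) (just z))
  inverse-sound f refl | yes (x , fx≡z) = fx≡z

  inverse-complete : (f : PAut d k) {z x : V} → proj₁ f x ≡ just z → inverse (proj₁ f) z ≡ just x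
  inverse-complete (f , f-paut) {z} {x} fx≡z with ∃-vertex? (λ x → Maybe.≡-dec _≟ᵛ_ (f x) (just z))
  ... | yes (x′ , fx′≡z) = cong just (IsPAut.injective f-paut x′ x z fx′≡z fx≡z)
  ... | no  ∄x          = ⊥-elim (∄x (x , fx≡z))

  _⁻¹ : PAut d k → PAut d k
  (f , f-paut) ⁻¹ = inverse f , record
    { injective = λ x y z ex ey →
        Maybe.just-injective (trans (sym (inverse-sound f ex)) (inverse-sound f ey))
    ; adj-iso   = λ x y x′ y′ ex ey →
        ⇔.sym (IsPAut.adj-iso f-paut x′ y′ x y (inverse-sound f ex) (inverse-sound f ey))
    }

  infixl 7 _⨾ᴾ_
  _⨾ᴾ_ : PAut d k → PAut d k → PAut d k
  (f , f-paut) ⨾ᴾ (g , g-paut) = (f ⨾ g) , record { injective = injective ; adj-iso = adj-iso }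
    where
    injective : ∀ x y z → (f ⨾ g) x ≡ just z → (f ⨾ g) y ≡ just z → x ≡ y
    injective x y z ex ey with >>=-≡-just (f x) g ex | >>=-≡-just (f y) g ey
    ... | u , fx≡u , gu≡z | v , fy≡v , gv≡z
      with IsPAut.injective g-paut u v z gu≡z gv≡z
    ... | refl = IsPAut.injective f-paut x y u fx≡u fy≡v
    adj-iso : ∀ x y x′ y′ → (f ⨾ g) x ≡ just x′ → (f ⨾ g) y ≡ just y′ → Adj x y ⇔ Adj x′ y′
    adj-iso x y x′ y′ ex ey with >>=-≡-just (f x) g ex | >>=-≡-just (f y) g ey
    ... | u , fx≡u , gu≡x′ | v , fy≡v , gv≡y′ =
      ⇔.trans (IsPAut.adj-iso f-paut x y u v fx≡u fy≡v) (IsPAut.adj-iso g-paut u v x′ y′ gu≡x′ gv≡y′)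

  infix 4 _⊆dom_
  _⊆dom_ : PMap d k → PMap d k → Set
  f ⊆dom g = ∀ {x y} → f x ≡ just y → ∃ λ z → g x ≡ just z

  ⊆dom⇒factors : (α β : PAut d k) → proj₁ α ⊆dom proj₁ β → proj₁ α ≈ (β · (β ⁻¹ ⨾ᴾ α))
  ⊆dom⇒factors α β α⊆β x with proj₁ β x in βx≡z
  ... | just z rewrite inverse-complete β βx≡z = refl
  ... | nothing with proj₁ α x in αx≡y
  ...   | just y  with () ← trans (sym βx≡z) (proj₂ (α⊆β αx≡y))
  ...   | nothing = refl

  ⊆dom⇒𝓡 : (α β : PAut d k) → proj₁ α ⊆dom proj₁ β → proj₁ β ⊆dom proj₁ α → α 𝓡 β
  ⊆dom⇒𝓡 α β α⊆β β⊆α =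
    inj₂ (β ⁻¹ ⨾ᴾ α , ⊆dom⇒factors α β α⊆β) , inj₂ (α ⁻¹ ⨾ᴾ β , ⊆dom⇒factors β α β⊆α)

  ≤R⇒⊆dom : (α β : PAut d k) → α ≤R β → proj₁ α ⊆dom proj₁ β
  ≤R⇒⊆dom α β (inj₁ α≈β)        {x} αx≡y = _ , trans (sym (α≈β x)) αx≡y
  ≤R⇒⊆dom α β (inj₂ (a , α≈βa)) {x} αx≡y
    with u , βx≡u , _ ← >>=-≡-just (proj₁ β x) (proj₁ a) (trans (sym (α≈βa x)) αx≡y) = u , βx≡u

  ⊆dom⇒DomIso : (f g : PMap d k) → f ⊆dom g → g ⊆dom f → DomIso f g
  ⊆dom⇒DomIso f g f⊆g g⊆f = record
    { to      = λ (x , _ , fx≡y) → x , f⊆g fx≡y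
    ; from    = λ (x , _ , gx≡y) → x , g⊆f gx≡y
    ; from∘to = λ _ → refl
    ; to∘from = λ _ → refl
    ; adj     = λ _ _ → ⇔.refl
    }

  𝓡⇒DomIso : (α β : PAut d k) → α 𝓡 β → α ≅dom β
  𝓡⇒DomIso α β (α≤β , β≤α) =
    ⊆dom⇒DomIso (proj₁ α) (proj₁ β) (≤R⇒⊆dom α β α≤β) (≤R⇒⊆dom β α β≤α)

  infix 4 _⊆ran_
  _⊆ran_ : PMap d k → PMap d k → Set
  f ⊆ran g = ∀ {x y} → f x ≡ just y → ∃ λ u → g u ≡ just y

  ≤L⇒⊆ran : (α β : PAut d k) → α ≤L β → proj₁ α ⊆ran proj₁ β
  ≤L⇒⊆ran α β (inj₁ α≈β)        {x} αx≡y = x , trans (sym (α≈β x)) αx≡y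
  ≤L⇒⊆ran α β (inj₂ (a , α≈aβ)) {x} αx≡y
    with u , _ , βu≡y ← >>=-≡-just (proj₁ a x) (proj₁ β) (trans (sym (α≈aβ x)) αx≡y) = u , βu≡y

  ⊆ran⇒DomIso : (α β : PAut d k) → proj₁ α ⊆ran proj₁ β → proj₁ β ⊆ran proj₁ α → α ≅dom β
  ⊆ran⇒DomIso (f , f-paut) (g , g-paut) f⊆g g⊆f = record
    { to      = to
    ; from    = from
    ; from∘to = λ (x , y , fx≡y) → IsPAut.injective f-paut _ x y (proj₂ (g⊆f (proj₂ (f⊆g fx≡y)))) fx≡y
    ; to∘from = λ (u , y , gu≡y) → IsPAut.injective g-paut _ u y (proj₂ (f⊆g (proj₂ (g⊆f gu≡y)))) gu≡y
    ; adj     = λ (x₁ , y₁ , fx₁≡y₁) (x₂ , y₂ , fx₂≡y₂) →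
        ⇔.trans (IsPAut.adj-iso f-paut x₁ x₂ y₁ y₂ fx₁≡y₁ fx₂≡y₂)
                (⇔.sym (IsPAut.adj-iso g-paut _ _ y₁ y₂ (proj₂ (f⊆g fx₁≡y₁)) (proj₂ (f⊆g fx₂≡y₂))))
    }
    where
    to : Dom f → Dom g
    to (_ , y , fx≡y) = proj₁ (f⊆g fx≡y) , y , proj₂ (f⊆g fx≡y)
    from : Dom g → Dom f
    from (_ , y , gu≡y) = proj₁ (g⊆f gu≡y) , y , proj₂ (g⊆f gu≡y)

  𝓛⇒DomIso : (α β : PAut d k) → α 𝓛 β → α ≅dom β
  𝓛⇒DomIso α β (α≤β , β≤α) = ⊆ran⇒DomIso α β (≤L⇒⊆ran α β α≤β) (≤L⇒⊆ran β α β≤α)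

  DomIso-trans : {f g h : PMap d k} → DomIso f g → DomIso g h → DomIso f h
  DomIso-trans {g = g} I J = record
    { to      = J.to ∘ I.to
    ; from    = I.from ∘ J.from
    ; from∘to = λ a → trans (cong (proj₁ ∘ I.from) (Dom-≡ g (J.from∘to (I.to a)))) (I.from∘to a)
    ; to∘from = λ c → trans (cong (proj₁ ∘ J.to) (Dom-≡ g (I.to∘from (J.from c)))) (J.to∘from c)
    ; adj     = λ a b → ⇔.trans (I.adj a b) (J.adj (I.to a) (I.to b))
    }
    where
    module I = DomIso I
    module J = DomIso J

  𝓓⇒DomIso : (σ τ : PAut d k) → σ 𝓓 τ → σ ≅dom τ
  𝓓⇒DomIso σ τ (ρ , σ𝓛ρ , ρ𝓡τ) = DomIso-trans (𝓛⇒DomIso σ ρ σ𝓛ρ) (𝓡⇒DomIso ρ τ ρ𝓡τ)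

  private
    extendAt : (f : PMap d k) (h : Dom f → V) (x : V) (m : Maybe V) → f x ≡ m → Maybe V
    extendAt f h x (just y) fx≡y = just (h (x , y , fx≡y))
    extendAt f h x nothing  _    = nothing

  extendDom : (f : PMap d k) → (Dom f → V) → PMap d k
  extendDom f h x = extendAt f h x (f x) refl

  extendDom-on-Dom : (f : PMap d k) (h : Dom f → V) (a : Dom f) → extendDom f h (proj₁ a) ≡ just (h a)
  extendDom-on-Dom f h a@(x , y , fx≡y) = go (f x) refl
    where
    go : (m : Maybe V) (fx≡m : f x ≡ m) → extendAt f h x m fx≡m ≡ just (h a)
    go (just _) _    = cong (just ∘ h) (Dom-≡ f refl)
    go nothing  fx≡∅ with () ← trans (sym fx≡∅) fx≡y

  extendDom-≡-just : (f : PMap d k) (h : Dom f → V) {x u : V} →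
                     extendDom f h x ≡ just u → Σ (Dom f) λ a → proj₁ a ≡ x × h a ≡ u
  extendDom-≡-just f h {x} = go (f x) refl
    where
    go : ∀ {u} (m : Maybe V) (fx≡m : f x ≡ m) → extendAt f h x m fx≡m ≡ just u →
         Σ (Dom f) λ a → proj₁ a ≡ x × h a ≡ u
    go (just y) fx≡y refl = (x , y , fx≡y) , refl , refl

  module FromDomIso (σ τ : PAut d k) (I : σ ≅dom τ) where
    open DomIso I

    φ : PAut d k
    φ = extendDom (proj₁ σ) (proj₁ ∘ to) , record { injective = injective ; adj-iso = adj-iso }
      where
      injective : ∀ x y z → extendDom (proj₁ σ) (proj₁ ∘ to) x ≡ just z →
                  extendDom (proj₁ σ) (proj₁ ∘ to) y ≡ just z → x ≡ y
      injective x y z ex ey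
        with a , refl , toa≡z ← extendDom-≡-just (proj₁ σ) (proj₁ ∘ to) ex
           | b , refl , tob≡z ← extendDom-≡-just (proj₁ σ) (proj₁ ∘ to) ey =
        trans (sym (from∘to a))
              (trans (cong (proj₁ ∘ from) (Dom-≡ (proj₁ τ) (trans toa≡z (sym tob≡z)))) (from∘to b))
      adj-iso : ∀ x y x′ y′ → extendDom (proj₁ σ) (proj₁ ∘ to) x ≡ just x′ →
                extendDom (proj₁ σ) (proj₁ ∘ to) y ≡ just y′ → Adj x y ⇔ Adj x′ y′
      adj-iso x y x′ y′ ex ey
        with a , refl , refl ← extendDom-≡-just (proj₁ σ) (proj₁ ∘ to) ex
           | b , refl , refl ← extendDom-≡-just (proj₁ σ) (proj₁ ∘ to) ey = adj a b

    ρ : PAut d k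
    ρ = φ ⁻¹ ⨾ᴾ σ

    σ⊆φ : proj₁ σ ⊆dom proj₁ φ
    σ⊆φ {x} {y} σx≡y = _ , extendDom-on-Dom (proj₁ σ) (proj₁ ∘ to) (x , y , σx≡y)

    ρ⊆τ : proj₁ ρ ⊆dom proj₁ τ
    ρ⊆τ {y} ρy≡z
      with x , φ⁻¹y≡x , _ ← >>=-≡-just (inverse (proj₁ φ) y) (proj₁ σ) ρy≡z
      with a , refl , refl ← extendDom-≡-just (proj₁ σ) (proj₁ ∘ to) (inverse-sound (proj₁ φ) φ⁻¹y≡x)
      = proj₂ (to a)

    τ⊆ρ : proj₁ τ ⊆dom proj₁ ρ
    τ⊆ρ {y} {w} τy≡w =
      proj₁ (proj₂ b) , trans (cong (_>>= proj₁ σ) (inverse-complete φ φb≡y)) (proj₂ (proj₂ b))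
      where
      b : Dom (proj₁ σ)
      b = from (y , w , τy≡w)
      φb≡y : proj₁ φ (proj₁ b) ≡ just y
      φb≡y = trans (extendDom-on-Dom (proj₁ σ) (proj₁ ∘ to) b) (cong just (to∘from (y , w , τy≡w)))

    σ𝓓τ : σ 𝓓 τ
    σ𝓓τ = ρ , (inj₂ (φ , ⊆dom⇒factors σ φ σ⊆φ) , inj₂ (φ ⁻¹ , λ _ → refl)) , ⊆dom⇒𝓡 ρ τ ρ⊆τ τ⊆ρ

mainTheorem7 : (d k : ℕ) (σ τ : PAut d k) → (σ 𝓓 τ) ⇔ (σ ≅dom τ)
mainTheorem7 d k σ τ = mk⇔ (𝓓⇒DomIso σ τ) (FromDomIso.σ𝓓τ σ τ)
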